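{- Let $q,u,v,x,y$ be indeterminates (generic parameters). For integers $i,j$ define $\mathcal N^{(u,v;x,y)}_{ij}=0$ if $i<j$, and for $i\ge j$ $$\mathcal N^{(u,v;x,y)}_{ij}=y^{i-j}\,\frac{(x/y;q)_{i-j}}{(q;q)_{i-j}}\,\frac{(uq^j;q)_{i-j}}{(vq^{j+1};q)_{i-j}}\,\frac{(v^2q^{2j+1};q)_{2i-2j}}{(xv^2q^{i+j};q)_{i-j}\,(yv^2q^{2j+1};q)_{i-j}}.$$ Then the infinite lower-triangular matrices $\mathcal N(u,v;x,y)=(\mathcal N^{(u,v;x,y)}_{ij})_{i,j\in\mathbb Z}$ and $\mathcal N(u,v;y,x)$ are mutually inverse.
   Context: For an indeterminate $a$ and integer $k\ge 0$, $(a;q)_k=\prod_{m=0}^{k-1}(1-aq^m)$. A matrix $(f_{ij})_{i,j\in\mathbb Z}$ is lower-triangular if $f_{ij}=0$ unless $i\ge j$; two such matrices $(f_{ij})$, $(g_{kl})$ are mutually inverse if $\sum_{i\ge j\ge k}f_{ij}g_{jk}=\delta_{ik}$ for all $i,k$. -}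

module Defs where

open import Level using (Level; _⊔_)
open import Algebra.Bundles using (CommutativeRing)
open import Relation.Nullary using (¬_)
open import Data.Nat as ℕ using (ℕ; zero; suc)
open import Data.Integer as ℤ using (ℤ; +_; -[1+_]; ∣_∣)
open import Data.Bool using (if_then_else_)
open import Relation.Nullary.Decidable using (does)
open import Data.Product using (_×_)

-- The inverse is a total operation whose
-- value at 0 is irrelevant (only used at nonzero arguments).
record Field (c ℓ : Level) : Set (Level.suc (c ⊔ ℓ)) where
  field
    commutativeRing : CommutativeRing c ℓ
  open CommutativeRing commutativeRing public
  field
    _⁻¹      : Carrier → Carrier
    0≉1      : ¬ (0# ≈ 1#)
    inverseʳ : ∀ a → ¬ (a ≈ 0#) → a * (a ⁻¹) ≈ 1#

module _ {c ℓ : Level} (F : Field c ℓ) where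
  open Field F hiding (zero)

  pow : Carrier → ℕ → Carrier
  pow a zero    = 1#
  pow a (suc n) = a * pow a n

  zpow : Carrier → ℤ → Carrier
  zpow a (+ n)      = pow a n
  zpow a -[1+ n ]   = pow (a ⁻¹) (suc n)

  qPoch : Carrier → Carrier → ℕ → Carrier
  qPoch q a zero    = 1#
  qPoch q a (suc n) = qPoch q a n * (1# - a * pow q n)

  _/_ : Carrier → Carrier → Carrier
  a / b = a * (b ⁻¹)

  Nmat : (q u v x y : Carrier) → ℤ → ℤ → Carrier
  Nmat q u v x y i j =
    if does (i ℤ.<? j) then 0#
    else (pow y n * (qPoch q (x / y) n / qPoch q q n)
                  * (qPoch q (u * zpow q j) n
                       / qPoch q (v * zpow q (j ℤ.+ ℤ.1ℤ)) n)
                  * (qPoch q (v * v * zpow q (2ℤ ℤ.* j ℤ.+ ℤ.1ℤ)) (n ℕ.+ n)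
                       / (qPoch q (x * (v * v) * zpow q (i ℤ.+ j)) n
                          * qPoch q (y * (v * v) * zpow q (2ℤ ℤ.* j ℤ.+ ℤ.1ℤ)) n)))
    where
      n : ℕ
      n = ∣ i ℤ.- j ∣
      2ℤ : ℤ
      2ℤ = + 2

  sumUpTo : ℕ → (ℕ → Carrier) → Carrier
  sumUpTo zero    f = f zero
  sumUpTo (suc n) f = sumUpTo n f + f (suc n)

  sumBetween : ℤ → ℤ → (ℤ → Carrier) → Carrier
  sumBetween k i f =
    if does (i ℤ.<? k) then 0#
    else sumUpTo ∣ i ℤ.- k ∣ (λ t → f (k ℤ.+ + t))

  δ : ℤ → ℤ → Carrier
  δ i k = if does (i ℤ.≟ k) then 1# else 0#

  -- lower-triangular matrices (indexed by ℤ × ℤ) that are mutually inverse: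
  -- Σ_{i ≥ j ≥ k} f i j * g j k = δ i k for all i, k.
  MutuallyInverse : (ℤ → ℤ → Carrier) → (ℤ → ℤ → Carrier) → Set ℓ
  MutuallyInverse f g =
    ∀ i k → sumBetween k i (λ j → f i j * g j k) ≈ δ i k

  -- genericity of the parameters: every factor that may occur in a
  -- denominator (or be inverted) is nonzero.  This holds when q,u,v,x,y
  -- are indeterminates (in the field of rational functions).
  Generic : (q u v x y : Carrier) → Set ℓ
  Generic q u v x y =
      ¬ (q ≈ 0#) × ¬ (x ≈ 0#) × ¬ (y ≈ 0#)
    × (∀ (m : ℕ) → ¬ (1# - pow q (suc m) ≈ 0#))
    × (∀ (m : ℤ) → ¬ (1# - v * zpow q m ≈ 0#))
    × (∀ (m : ℤ) → ¬ (1# - x * (v * v) * zpow q m ≈ 0#))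
    × (∀ (m : ℤ) → ¬ (1# - y * (v * v) * zpow q m ≈ 0#))

-- Fix the column k and put K = q^k, V = v K, w = V².  For i = k + n the (i, k) entry of the
-- product is the sum over s + t = n of N(x,y)_{k+t+s, k+t} N(y,x)_{k+t, k}, and each such term
-- factors as C_n T_n(s, t), where C_n depends on n only and T_n(s, t) is an explicit ratio of
-- q-shifted factorials.  With κ_n = (1 - x w q^n)(1 - q^n), the terms telescope:
-- κ_n T_n(n, 0) = G_n(n, 0) and κ_n T_n(s, t + 1) = G_n(s, t + 1) - G_n(s + 1, t), for a
-- certificate G_n(s, t) that carries the factor 1 - q^s.  Hence κ_n times the sum is
-- G_n(0, n) = 0, and the entry vanishes for n ≥ 1, where κ_n ≠ 0.  Diagonal entries are 1.
module Submission where

open import Defs hiding (_/_)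
open import Level using (Level)

open import Algebra.Bundles using (CommutativeRing)
import Algebra.Properties.Ring as RingProperties
import Algebra.Properties.Semiring.Mult.TCOptimised as SemiringMultiplication
open import Algebra.Solver.Ring.AlmostCommutativeRing
  using (fromCommutativeRing; _-Raw-AlmostCommutative⟶_)
import Algebra.Solver.Ring as RingSolver
open import Data.Integer as ℤ using (ℤ; +_; -[1+_]; _⊖_; _◃_; sign; ∣_∣)
import Data.Integer.Properties as ℤ
import Data.Integer.Solver
open import Data.Maybe using (map)
open import Data.Nat as ℕ using (ℕ; zero; suc)
import Data.Nat.Properties as ℕ
import Data.Nat.Solver
open import Data.Product using (_,_)
open import Data.Sign as Sign using (Sign)
open import Function using (id)
open import Relation.Binary.PropositionalEquality as ≡ using (_≡_; _≢_)
open import Relation.Nullary using (¬_; Dec; yes; no)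
open import Relation.Nullary.Decidable using (dec⇒maybe; dec-true; dec-false)

module IndexArithmetic where

  j+s≮j : ∀ j s → ¬ (j ℤ.+ + s ℤ.< j)
  j+s≮j j s = ℤ.≤⇒≯ (ℤ.i≤i+j j (+ s))

  j+s-j≡s : ∀ j s → j ℤ.+ + s ℤ.- j ≡ + s
  j+s-j≡s j s = solve 2 (λ j s → j :+ s :- j := s) ≡.refl j (+ s)
    where open Data.Integer.Solver.+-*-Solver

  ∣j+s-j∣≡s : ∀ j s → ∣ j ℤ.+ + s ℤ.- j ∣ ≡ s
  ∣j+s-j∣≡s j s = ≡.cong ∣_∣ (j+s-j≡s j s)

  2j≡j+j : ∀ j → + 2 ℤ.* j ≡ j ℤ.+ j
  2j≡j+j = solve 1 (λ j → con (+ 2) :* j := j :+ j) ≡.refl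
    where open Data.Integer.Solver.+-*-Solver

  [t+s]+[t+s]≡[t+t]+[s+s] : ∀ t s → (t ℕ.+ s) ℕ.+ (t ℕ.+ s) ≡ (t ℕ.+ t) ℕ.+ (s ℕ.+ s)
  [t+s]+[t+s]≡[t+t]+[s+s] = solve 2 (λ t s → (t :+ s) :+ (t :+ s) := (t :+ t) :+ (s :+ s)) ≡.refl
    where open Data.Nat.Solver.+-*-Solver

  [1+t+s]+t≡[1+t+t]+s : ∀ t s → suc (t ℕ.+ s) ℕ.+ t ≡ suc (t ℕ.+ t) ℕ.+ s
  [1+t+s]+t≡[1+t+t]+s = solve 2 (λ t s → (con 1 :+ t :+ s) :+ t := (con 1 :+ t :+ t) :+ s) ≡.refl
    where open Data.Nat.Solver.+-*-Solver

  k+n≡k+t+[n∸t] : ∀ k {t n} → t ℕ.≤ n → k ℤ.+ + n ≡ k ℤ.+ + t ℤ.+ + (n ℕ.∸ t)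
  k+n≡k+t+[n∸t] k {t} {n} t≤n = begin
    k ℤ.+ + n                       ≡⟨ ≡.cong (λ m → k ℤ.+ + m) (ℕ.m+[n∸m]≡n t≤n) ⟨
    k ℤ.+ + (t ℕ.+ (n ℕ.∸ t))        ≡⟨ ≡.cong (λ m → k ℤ.+ m) (ℤ.pos-+ t (n ℕ.∸ t)) ⟩
    k ℤ.+ (+ t ℤ.+ + (n ℕ.∸ t))      ≡⟨ ℤ.+-assoc k (+ t) (+ (n ℕ.∸ t)) ⟨
    k ℤ.+ + t ℤ.+ + (n ℕ.∸ t)        ∎
    where open ≡.≡-Reasoning

  k+∣i-k∣≡i : ∀ {i k} → ¬ (i ℤ.< k) → k ℤ.+ + ∣ i ℤ.- k ∣ ≡ i
  k+∣i-k∣≡i {i} {k} i≮k = begin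
    k ℤ.+ + ∣ i ℤ.- k ∣     ≡⟨ ≡.cong (λ m → k ℤ.+ + m) (ℤ.∣i-j∣≡∣j-i∣ i k) ⟩
    k ℤ.+ + ∣ k ℤ.- i ∣     ≡⟨ ≡.cong (λ m → k ℤ.+ m) (ℤ.∣-∣-≤ (ℤ.≮⇒≥ i≮k)) ⟩
    k ℤ.+ (i ℤ.- k)          ≡⟨ solve 2 (λ i k → k :+ (i :- k) := i) ≡.refl i k ⟩
    i                        ∎
    where
    open ≡.≡-Reasoning
    open Data.Integer.Solver.+-*-Solver

  k+[1+n]≢k : ∀ k n → k ℤ.+ + suc n ≢ k
  k+[1+n]≢k k n eq with ≡.trans (≡.sym (j+s-j≡s k (suc n))) (≡.trans (≡.cong (ℤ._- k) eq) (ℤ.+-inverseʳ k))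
  ... | ()

  n∸t≡1+[n∸[1+t]] : ∀ {n t} → t ℕ.< n → n ℕ.∸ t ≡ suc (n ℕ.∸ suc t)
  n∸t≡1+[n∸[1+t]] {suc n} {zero}  _           = ≡.refl
  n∸t≡1+[n∸[1+t]] {suc n} {suc t} (ℕ.s≤s t<n) = n∸t≡1+[n∸[1+t]] t<n

-- The carrier has no decidable equality, so the ring solver normalises with integer
-- coefficients, interpreted along the canonical map ℤ → R.
module IntegerCoefficientSolver {c ℓ} (R : CommutativeRing c ℓ) where
  open CommutativeRing R
  open RingProperties ring using (-0#≈0#; -‿+-comm; -‿involutive; -‿distribˡ-*; -‿distribʳ-*)
  open SemiringMultiplication semiring using (_×_; 1+×; ×-homo-+; ×1-homo-*)
  open import Relation.Binary.Reasoning.Setoid setoid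

  signed : Sign → Carrier → Carrier
  signed Sign.+ a = a
  signed Sign.- a = - a

  signed-cong : ∀ s {a b} → a ≈ b → signed s a ≈ signed s b
  signed-cong Sign.+ = id
  signed-cong Sign.- = -‿cong

  signed-* : ∀ s t a b → signed (s Sign.* t) (a * b) ≈ signed s a * signed t b
  signed-* Sign.+ Sign.+ a b = refl
  signed-* Sign.+ Sign.- a b = -‿distribʳ-* a b
  signed-* Sign.- Sign.+ a b = -‿distribˡ-* a b
  signed-* Sign.- Sign.- a b = begin
    a * b         ≈⟨ -‿involutive (a * b) ⟨
    - - (a * b)   ≈⟨ -‿cong (-‿distribʳ-* a b) ⟩
    - (a * - b)   ≈⟨ -‿distribˡ-* a (- b) ⟩
    - a * - b     ∎

  [1+a]-[1+b]≈a-b : ∀ a b → (1# + a) - (1# + b) ≈ a - b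
  [1+a]-[1+b]≈a-b a b = begin
    (1# + a) - (1# + b)     ≈⟨ +-congˡ (-‿+-comm 1# b) ⟨
    (1# + a) + (- 1# - b)   ≈⟨ +-assoc 1# a _ ⟩
    1# + (a + (- 1# - b))   ≈⟨ +-congˡ (+-assoc a (- 1#) (- b)) ⟨
    1# + ((a - 1#) - b)     ≈⟨ +-congˡ (+-congʳ (+-comm a (- 1#))) ⟩
    1# + ((- 1# + a) - b)   ≈⟨ +-congˡ (+-assoc (- 1#) a (- b)) ⟩
    1# + (- 1# + (a - b))   ≈⟨ +-assoc 1# (- 1#) _ ⟨
    (1# - 1#) + (a - b)     ≈⟨ +-congʳ (-‿inverseʳ 1#) ⟩
    0# + (a - b)            ≈⟨ +-identityˡ _ ⟩
    a - b                   ∎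

  ⟦_⟧ℤ : ℤ → Carrier
  ⟦ i ⟧ℤ = signed (sign i) (∣ i ∣ × 1#)

  ⟦◃⟧ : ∀ s n → ⟦ s ◃ n ⟧ℤ ≈ signed s (n × 1#)
  ⟦◃⟧ Sign.+ zero    = refl
  ⟦◃⟧ Sign.- zero    = sym -0#≈0#
  ⟦◃⟧ Sign.+ (suc n) = refl
  ⟦◃⟧ Sign.- (suc n) = refl

  ⟦⊖⟧ : ∀ m n → ⟦ m ⊖ n ⟧ℤ ≈ m × 1# - n × 1#
  ⟦⊖⟧ m       zero    = sym (trans (+-congˡ -0#≈0#) (+-identityʳ _))
  ⟦⊖⟧ zero    (suc n) = sym (+-identityˡ _)
  ⟦⊖⟧ (suc m) (suc n) = begin
    ⟦ suc m ⊖ suc n ⟧ℤ         ≡⟨ ≡.cong ⟦_⟧ℤ (ℤ.[1+m]⊖[1+n]≡m⊖n m n) ⟩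
    ⟦ m ⊖ n ⟧ℤ                 ≈⟨ ⟦⊖⟧ m n ⟩
    m × 1# - n × 1#                   ≈⟨ [1+a]-[1+b]≈a-b (m × 1#) (n × 1#) ⟨
    (1# + m × 1#) - (1# + n × 1#)     ≈⟨ +-cong (1+× m 1#) (-‿cong (1+× n 1#)) ⟨
    suc m × 1# - suc n × 1#           ∎

  ⟦+⟧ : ∀ i j → ⟦ i ℤ.+ j ⟧ℤ ≈ ⟦ i ⟧ℤ + ⟦ j ⟧ℤ
  ⟦+⟧ (+ m)    (+ n)    = ×-homo-+ 1# m n
  ⟦+⟧ (+ m)    -[1+ n ] = ⟦⊖⟧ m (suc n)
  ⟦+⟧ -[1+ m ] (+ n)    = trans (⟦⊖⟧ n (suc m)) (+-comm _ _)
  ⟦+⟧ -[1+ m ] -[1+ n ] = begin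
    - (suc (suc (m ℕ.+ n)) × 1#)     ≡⟨ ≡.cong (λ k → - (k × 1#)) (ℕ.+-suc (suc m) n) ⟨
    - ((suc m ℕ.+ suc n) × 1#)       ≈⟨ -‿cong (×-homo-+ 1# (suc m) (suc n)) ⟩
    - (suc m × 1# + suc n × 1#)      ≈⟨ -‿+-comm _ _ ⟨
    - (suc m × 1#) - (suc n × 1#)    ∎

  ⟦*⟧ : ∀ i j → ⟦ i ℤ.* j ⟧ℤ ≈ ⟦ i ⟧ℤ * ⟦ j ⟧ℤ
  ⟦*⟧ i j = begin
    ⟦ sign i Sign.* sign j ◃ ∣ i ∣ ℕ.* ∣ j ∣ ⟧ℤ                 ≈⟨ ⟦◃⟧ (sign i Sign.* sign j) (∣ i ∣ ℕ.* ∣ j ∣) ⟩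
    signed (sign i Sign.* sign j) ((∣ i ∣ ℕ.* ∣ j ∣) × 1#)    ≈⟨ signed-cong (sign i Sign.* sign j) (×1-homo-* ∣ i ∣ ∣ j ∣) ⟩
    signed (sign i Sign.* sign j) (∣ i ∣ × 1# * ∣ j ∣ × 1#)   ≈⟨ signed-* (sign i) (sign j) _ _ ⟩
    ⟦ i ⟧ℤ * ⟦ j ⟧ℤ                                            ∎

  ⟦-⟧ : ∀ i → ⟦ ℤ.- i ⟧ℤ ≈ - ⟦ i ⟧ℤ
  ⟦-⟧ (+ zero)  = sym -0#≈0#
  ⟦-⟧ (+ suc n) = refl
  ⟦-⟧ -[1+ n ]  = sym (-‿involutive _)

  ℤ-morphism : ℤ.+-*-rawRing -Raw-AlmostCommutative⟶ fromCommutativeRing R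
  ℤ-morphism = record
    { ⟦_⟧    = ⟦_⟧ℤ
    ; +-homo = ⟦+⟧
    ; *-homo = ⟦*⟧
    ; -‿homo = ⟦-⟧
    ; 0-homo = refl
    ; 1-homo = refl
    }

  open RingSolver ℤ.+-*-rawRing (fromCommutativeRing R) ℤ-morphism
    (λ i j → map (λ i≡j → reflexive (≡.cong ⟦_⟧ℤ i≡j)) (dec⇒maybe (i ℤ.≟ j)))
    public using (solve; _:=_; _:+_; _:-_; _:*_; con)

module FieldProperties {c ℓ} (F : Field c ℓ) where
  open Field F hiding (zero)
  open IntegerCoefficientSolver commutativeRing
  open import Relation.Binary.Reasoning.Setoid setoid

  infixl 7 _/_
  _/_ : Carrier → Carrier → Carrier
  _/_ = Defs._/_ F

  inverseˡ : ∀ a → a ≉ 0# → a ⁻¹ * a ≈ 1#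
  inverseˡ a a≉0 = trans (*-comm _ _) (inverseʳ a a≉0)

  x*y≈0⇒y≈0 : ∀ {a b} → a ≉ 0# → a * b ≈ 0# → b ≈ 0#
  x*y≈0⇒y≈0 {a} {b} a≉0 ab≈0 = begin
    b                ≈⟨ *-identityˡ b ⟨
    1# * b           ≈⟨ *-congʳ (inverseˡ a a≉0) ⟨
    (a ⁻¹ * a) * b   ≈⟨ *-assoc _ _ _ ⟩
    a ⁻¹ * (a * b)   ≈⟨ *-congˡ ab≈0 ⟩
    a ⁻¹ * 0#        ≈⟨ zeroʳ _ ⟩
    0#               ∎

  *-≉0 : ∀ {a b} → a ≉ 0# → b ≉ 0# → a * b ≉ 0#
  *-≉0 a≉0 b≉0 ab≈0 = b≉0 (x*y≈0⇒y≈0 a≉0 ab≈0)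

  1≉0 : 1# ≉ 0#
  1≉0 1≈0 = 0≉1 (sym 1≈0)

  p*[a/b]*[c/d]*[e/g]*[b*d*g]≈p*a*c*e : ∀ {b d g} → b ≉ 0# → d ≉ 0# → g ≉ 0# → ∀ p a c e →
    p * (a / b) * (c / d) * (e / g) * (b * d * g) ≈ p * a * c * e
  p*[a/b]*[c/d]*[e/g]*[b*d*g]≈p*a*c*e {b} {d} {g} b≉0 d≉0 g≉0 p a c e = begin
    p * (a / b) * (c / d) * (e / g) * (b * d * g)                  ≈⟨ regroup p a c e b d g (b ⁻¹) (d ⁻¹) (g ⁻¹) ⟩
    p * a * c * e * ((b ⁻¹ * b) * (d ⁻¹ * d) * (g ⁻¹ * g))          ≈⟨ *-congˡ (*-cong (*-cong (inverseˡ b b≉0) (inverseˡ d d≉0)) (inverseˡ g g≉0)) ⟩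
    p * a * c * e * (1# * 1# * 1#)                                 ≈⟨ unit (p * a * c * e) ⟩
    p * a * c * e                                                  ∎
    where
    regroup : ∀ p a c e b d g b′ d′ g′ →
      p * (a * b′) * (c * d′) * (e * g′) * (b * d * g) ≈ p * a * c * e * ((b′ * b) * (d′ * d) * (g′ * g))
    regroup = solve 10 (λ p a c e b d g b′ d′ g′ →
      p :* (a :* b′) :* (c :* d′) :* (e :* g′) :* (b :* d :* g)
        := p :* a :* c :* e :* ((b′ :* b) :* (d′ :* d) :* (g′ :* g))) refl
    unit : ∀ z → z * (1# * 1# * 1#) ≈ z
    unit = solve 1 (λ z → z :* (con (+ 1) :* con (+ 1) :* con (+ 1)) := z) refl

  x*[b*d]≈a*c⇒x≈[a/b]*[c/d] : ∀ {x a b c d} → b ≉ 0# → d ≉ 0# → x * (b * d) ≈ a * c → x ≈ (a / b) * (c / d)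
  x*[b*d]≈a*c⇒x≈[a/b]*[c/d] {x} {a} {b} {c} {d} b≉0 d≉0 eq = begin
    x                                 ≈⟨ *-identityʳ x ⟨
    x * 1#                            ≈⟨ *-congˡ (*-identityʳ 1#) ⟨
    x * (1# * 1#)                     ≈⟨ *-congˡ (*-cong (inverseʳ b b≉0) (inverseʳ d d≉0)) ⟨
    x * ((b * b ⁻¹) * (d * d ⁻¹))     ≈⟨ regroup x b d (b ⁻¹) (d ⁻¹) ⟩
    (x * (b * d)) * (b ⁻¹ * d ⁻¹)     ≈⟨ *-congʳ eq ⟩
    (a * c) * (b ⁻¹ * d ⁻¹)           ≈⟨ regroup′ a c (b ⁻¹) (d ⁻¹) ⟩
    (a / b) * (c / d)                 ∎
    where
    regroup : ∀ x b d b′ d′ → x * ((b * b′) * (d * d′)) ≈ (x * (b * d)) * (b′ * d′)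
    regroup = solve 5 (λ x b d b′ d′ → x :* ((b :* b′) :* (d :* d′)) := (x :* (b :* d)) :* (b′ :* d′)) refl
    regroup′ : ∀ a c b′ d′ → (a * c) * (b′ * d′) ≈ (a * b′) * (c * d′)
    regroup′ = solve 4 (λ a c b′ d′ → (a :* c) :* (b′ :* d′) := (a :* b′) :* (c :* d′)) refl

  c*b≈[a-e]*d⇒c/d+e/b≈a/b : ∀ {a b c d e} → b ≉ 0# → d ≉ 0# → c * b ≈ (a - e) * d → c / d + e / b ≈ a / b
  c*b≈[a-e]*d⇒c/d+e/b≈a/b {a} {b} {c} {d} {e} b≉0 d≉0 eq = begin
    c / d + e / b                        ≈⟨ +-congʳ (*-identityʳ _) ⟨
    c / d * 1# + e / b                   ≈⟨ +-congʳ (*-congˡ (inverseʳ b b≉0)) ⟨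
    c / d * (b * b ⁻¹) + e / b           ≈⟨ +-congʳ (regroup c (d ⁻¹) b (b ⁻¹)) ⟩
    (c * b) * d ⁻¹ * b ⁻¹ + e / b        ≈⟨ +-congʳ (*-congʳ (*-congʳ eq)) ⟩
    (a - e) * d * d ⁻¹ * b ⁻¹ + e / b    ≈⟨ +-congʳ (*-congʳ (*-assoc _ _ _)) ⟩
    (a - e) * (d * d ⁻¹) * b ⁻¹ + e / b  ≈⟨ +-congʳ (*-congʳ (*-congˡ (inverseʳ d d≉0))) ⟩
    (a - e) * 1# * b ⁻¹ + e / b          ≈⟨ recombine a e (b ⁻¹) ⟩
    a / b                                ∎
    where
    regroup : ∀ c d′ b b′ → c * d′ * (b * b′) ≈ (c * b) * d′ * b′
    regroup = solve 4 (λ c d′ b b′ → c :* d′ :* (b :* b′) := (c :* b) :* d′ :* b′) refl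
    recombine : ∀ a e b′ → (a - e) * 1# * b′ + e * b′ ≈ a * b′
    recombine = solve 3 (λ a e b′ → (a :- e) :* con (+ 1) :* b′ :+ e :* b′ := a :* b′) refl

module QSeries {c ℓ} (F : Field c ℓ) (q : Field.Carrier F) where
  open Field F hiding (zero)
  open FieldProperties F
  open IndexArithmetic using ([1+t+s]+t≡[1+t+t]+s)
  open IntegerCoefficientSolver commutativeRing
  open import Relation.Binary.Reasoning.Setoid setoid

  infixr 8 _^_ _^ℤ_
  _^_ : Carrier → ℕ → Carrier
  _^_ = pow F

  _^ℤ_ : Carrier → ℤ → Carrier
  _^ℤ_ = zpow F

  poch : Carrier → ℕ → Carrier
  poch = qPoch F q

  ^-+ : ∀ a m n → a ^ (m ℕ.+ n) ≈ a ^ m * a ^ n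
  ^-+ a zero    n = sym (*-identityˡ _)
  ^-+ a (suc m) n = trans (*-congˡ (^-+ a m n)) (sym (*-assoc _ _ _))

  module _ (q≉0 : q ≉ 0#) where

    ^ℤ-⊖ : ∀ m n → q ^ℤ (m ⊖ n) ≈ q ^ m * q ⁻¹ ^ n
    ^ℤ-⊖ m       zero    = sym (*-identityʳ _)
    ^ℤ-⊖ zero    (suc n) = sym (*-identityˡ _)
    ^ℤ-⊖ (suc m) (suc n) = begin
      q ^ℤ (suc m ⊖ suc n)                  ≡⟨ ≡.cong (q ^ℤ_) (ℤ.[1+m]⊖[1+n]≡m⊖n m n) ⟩
      q ^ℤ (m ⊖ n)                          ≈⟨ ^ℤ-⊖ m n ⟩
      q ^ m * q ⁻¹ ^ n                      ≈⟨ *-identityˡ _ ⟨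
      1# * (q ^ m * q ⁻¹ ^ n)               ≈⟨ *-congʳ (inverseʳ q q≉0) ⟨
      (q * q ⁻¹) * (q ^ m * q ⁻¹ ^ n)       ≈⟨ regroup q (q ⁻¹) (q ^ m) (q ⁻¹ ^ n) ⟩
      q ^ suc m * q ⁻¹ ^ suc n              ∎
      where
      regroup : ∀ a b c d → (a * b) * (c * d) ≈ (a * c) * (b * d)
      regroup = solve 4 (λ a b c d → (a :* b) :* (c :* d) := (a :* c) :* (b :* d)) refl

    ^ℤ-+ : ∀ i j → q ^ℤ (i ℤ.+ j) ≈ q ^ℤ i * q ^ℤ j
    ^ℤ-+ (+ m)    (+ n)    = ^-+ q m n
    ^ℤ-+ (+ m)    -[1+ n ] = ^ℤ-⊖ m (suc n)
    ^ℤ-+ -[1+ m ] (+ n)    = trans (^ℤ-⊖ n (suc m)) (*-comm _ _)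
    ^ℤ-+ -[1+ m ] -[1+ n ] = begin
      q ⁻¹ * q ⁻¹ ^ suc (m ℕ.+ n)               ≈⟨ *-congˡ (*-congˡ (^-+ (q ⁻¹) m n)) ⟩
      q ⁻¹ * (q ⁻¹ * (q ⁻¹ ^ m * q ⁻¹ ^ n))     ≈⟨ regroup (q ⁻¹) (q ⁻¹ ^ m) (q ⁻¹ ^ n) ⟩
      q ⁻¹ ^ suc m * q ⁻¹ ^ suc n               ∎
      where
      regroup : ∀ a b c → a * (a * (b * c)) ≈ (a * b) * (a * c)
      regroup = solve 3 (λ a b c → a :* (a :* (b :* c)) := (a :* b) :* (a :* c)) refl

    *q^ℤ-* : ∀ a z m → a * q ^ℤ z * q ^ m ≈ a * q ^ℤ (z ℤ.+ + m)
    *q^ℤ-* a z m = trans (*-assoc _ _ _) (*-congˡ (sym (^ℤ-+ z (+ m))))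

    *q^ℤ-factor≉0 : ∀ {a} → (∀ z → 1# - a * q ^ℤ z ≉ 0#) → ∀ z m → 1# - a * q ^ℤ z * q ^ m ≉ 0#
    *q^ℤ-factor≉0 {a} factor≉0 z m eq = factor≉0 (z ℤ.+ + m) (trans (+-congˡ (-‿cong (sym (*q^ℤ-* a z m)))) eq)

  *q-factor≉0 : ∀ {a} → (∀ m → 1# - a * q ^ m ≉ 0#) → ∀ m → 1# - a * q * q ^ m ≉ 0#
  *q-factor≉0 factor≉0 m eq = factor≉0 (suc m) (trans (+-congˡ (-‿cong (sym (*-assoc _ _ _)))) eq)

  *q^-factor≉0 : ∀ {a} → (∀ m → 1# - a * q ^ m ≉ 0#) → ∀ n m → 1# - a * q ^ n * q ^ m ≉ 0#
  *q^-factor≉0 {a} factor≉0 n m eq = factor≉0 (n ℕ.+ m) (trans (+-congˡ (-‿cong shift)) eq)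
    where
    shift : a * q ^ (n ℕ.+ m) ≈ a * q ^ n * q ^ m
    shift = trans (*-congˡ (^-+ q n m)) (sym (*-assoc _ _ _))

  poch-cong : ∀ {a b} → a ≈ b → ∀ n → poch a n ≈ poch b n
  poch-cong a≈b zero    = refl
  poch-cong a≈b (suc n) = *-cong (poch-cong a≈b n) (+-congˡ (-‿cong (*-congʳ a≈b)))

  poch-+ : ∀ a m n → poch a (m ℕ.+ n) ≈ poch a m * poch (a * q ^ m) n
  poch-+ a m zero    = ≡.subst (λ k → poch a k ≈ poch a m * 1#) (≡.sym (ℕ.+-identityʳ m)) (sym (*-identityʳ _))
  poch-+ a m (suc n) = begin
    poch a (m ℕ.+ suc n)                                             ≡⟨ ≡.cong (poch a) (ℕ.+-suc m n) ⟩
    poch a (m ℕ.+ n) * (1# - a * q ^ (m ℕ.+ n))                      ≈⟨ *-cong (poch-+ a m n) (+-congˡ (-‿cong (*-congˡ (^-+ q m n)))) ⟩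
    poch a m * poch (a * q ^ m) n * (1# - a * (q ^ m * q ^ n))       ≈⟨ *-assoc _ _ _ ⟩
    poch a m * (poch (a * q ^ m) n * (1# - a * (q ^ m * q ^ n)))     ≈⟨ *-congˡ (*-congˡ (+-congˡ (-‿cong (*-assoc _ _ _)))) ⟨
    poch a m * poch (a * q ^ m) (suc n)                              ∎

  poch-[1+t+s]+t : ∀ a t s →
    poch a (suc (t ℕ.+ s)) * poch (a * q ^ suc (t ℕ.+ s)) t
      ≈ poch a t * poch (a * q ^ t) t * (1# - a * q ^ (t ℕ.+ t)) * poch (a * q ^ suc (t ℕ.+ t)) s
  poch-[1+t+s]+t a t s = begin
    poch a (suc (t ℕ.+ s)) * poch (a * q ^ suc (t ℕ.+ s)) t    ≈⟨ poch-+ a (suc (t ℕ.+ s)) t ⟨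
    poch a (suc (t ℕ.+ s) ℕ.+ t)                               ≡⟨ ≡.cong (poch a) ([1+t+s]+t≡[1+t+t]+s t s) ⟩
    poch a (suc (t ℕ.+ t) ℕ.+ s)                               ≈⟨ poch-+ a (suc (t ℕ.+ t)) s ⟩
    poch a (t ℕ.+ t) * (1# - a * q ^ (t ℕ.+ t)) * poch (a * q ^ suc (t ℕ.+ t)) s
                                                               ≈⟨ *-congʳ (*-congʳ (poch-+ a t t)) ⟩
    poch a t * poch (a * q ^ t) t * (1# - a * q ^ (t ℕ.+ t)) * poch (a * q ^ suc (t ℕ.+ t)) s ∎

  poch-≉0 : ∀ {a} → (∀ m → 1# - a * q ^ m ≉ 0#) → ∀ n → poch a n ≉ 0#
  poch-≉0 factor≉0 zero    = 1≉0
  poch-≉0 factor≉0 (suc n) = *-≉0 (poch-≉0 factor≉0 n) (factor≉0 n)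

  homPoch : Carrier → Carrier → ℕ → Carrier
  homPoch a b zero    = 1#
  homPoch a b (suc n) = homPoch a b n * (a - b * q ^ n)

  homPoch-suc : ∀ a b n → homPoch a b (suc n) ≈ (a - b) * homPoch a (b * q) n
  homPoch-suc a b zero    = solve 2 (λ a b → con (+ 1) :* (a :- b :* con (+ 1)) := (a :- b) :* con (+ 1)) refl a b
  homPoch-suc a b (suc n) = begin
    homPoch a b (suc n) * (a - b * (q * q ^ n))                   ≈⟨ *-congʳ (homPoch-suc a b n) ⟩
    (a - b) * homPoch a (b * q) n * (a - b * (q * q ^ n))         ≈⟨ regroup a b q (q ^ n) (homPoch a (b * q) n) ⟩
    (a - b) * (homPoch a (b * q) n * (a - b * q * q ^ n))         ∎
    where
    regroup : ∀ a b q p h → (a - b) * h * (a - b * (q * p)) ≈ (a - b) * (h * (a - b * q * p))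
    regroup = solve 5 (λ a b q p h → (a :- b) :* h :* (a :- b :* (q :* p)) := (a :- b) :* (h :* (a :- b :* q :* p))) refl

  ^*poch[/]≈homPoch : ∀ {a b} → b ≉ 0# → ∀ n → b ^ n * poch (a / b) n ≈ homPoch b a n
  ^*poch[/]≈homPoch b≉0 zero    = *-identityˡ 1#
  ^*poch[/]≈homPoch {a} {b} b≉0 (suc n) = begin
    b * b ^ n * (poch (a / b) n * (1# - a / b * q ^ n))           ≈⟨ regroup b (b ^ n) (poch (a / b) n) a (b ⁻¹) (q ^ n) ⟩
    b ^ n * poch (a / b) n * (b - (b * b ⁻¹) * a * q ^ n)         ≈⟨ *-cong (^*poch[/]≈homPoch b≉0 n) (+-congˡ (-‿cong (*-congʳ (trans (*-congʳ (inverseʳ b b≉0)) (*-identityˡ a))))) ⟩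
    homPoch b a n * (b - a * q ^ n)                               ∎
    where
    regroup : ∀ b bⁿ P a b′ qⁿ → b * bⁿ * (P * (1# - a * b′ * qⁿ)) ≈ bⁿ * P * (b - (b * b′) * a * qⁿ)
    regroup = solve 6 (λ b bⁿ P a b′ qⁿ →
      b :* bⁿ :* (P :* (con (+ 1) :- a :* b′ :* qⁿ)) := bⁿ :* P :* (b :- (b :* b′) :* a :* qⁿ)) refl

module Summation {c ℓ} (F : Field c ℓ) where
  open Field F hiding (zero)
  open IndexArithmetic

  sumBetween-empty : ∀ {k i} f → i ℤ.< k → sumBetween F k i f ≡ 0#
  sumBetween-empty {k} {i} f i<k rewrite dec-true (i ℤ.<? k) i<k = ≡.refl

  sumBetween-offset : ∀ k n f → sumBetween F k (k ℤ.+ + n) f ≡ sumUpTo F n (λ t → f (k ℤ.+ + t))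
  sumBetween-offset k n f rewrite dec-false (k ℤ.+ + n ℤ.<? k) (j+s≮j k n) | ∣j+s-j∣≡s k n = ≡.refl

  sumUpTo-cong : ∀ m {f g : ℕ → Carrier} → (∀ t → t ℕ.≤ m → f t ≈ g t) → sumUpTo F m f ≈ sumUpTo F m g
  sumUpTo-cong zero    f≈g = f≈g 0 ℕ.z≤n
  sumUpTo-cong (suc m) f≈g =
    +-cong (sumUpTo-cong m (λ t t≤m → f≈g t (ℕ.m≤n⇒m≤1+n t≤m))) (f≈g (suc m) ℕ.≤-refl)

  sumUpTo-*ˡ : ∀ m a (f : ℕ → Carrier) → sumUpTo F m (λ t → a * f t) ≈ a * sumUpTo F m f
  sumUpTo-*ˡ zero    a f = refl
  sumUpTo-*ˡ (suc m) a f = trans (+-congʳ (sumUpTo-*ˡ m a f)) (sym (distribˡ _ _ _))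

  telescope : ∀ m (f g : ℕ → Carrier) → f 0 ≈ g 0 → (∀ t → t ℕ.< m → g t + f (suc t) ≈ g (suc t)) →
              sumUpTo F m f ≈ g m
  telescope zero    f g f0≈g0 step = f0≈g0
  telescope (suc m) f g f0≈g0 step =
    trans (+-congʳ (telescope m f g f0≈g0 (λ t t<m → step t (ℕ.m<n⇒m<1+n t<m)))) (step m ℕ.≤-refl)

module MatrixInversion {c ℓ} (F : Field c ℓ) (q u v : Field.Carrier F) where
  open Field F hiding (zero)
  open FieldProperties F
  open QSeries F q
  open Summation F
  open IntegerCoefficientSolver commutativeRing
  open IndexArithmetic
  open import Relation.Binary.Reasoning.Setoid setoid

  N : Carrier → Carrier → ℤ → ℤ → Carrier
  N = Nmat F q u v

  δ-≡ : ∀ {i k} → i ≡ k → δ F i k ≡ 1#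
  δ-≡ {i} {k} i≡k rewrite dec-true (i ℤ.≟ k) i≡k = ≡.refl

  δ-≢ : ∀ {i k} → i ≢ k → δ F i k ≡ 0#
  δ-≢ {i} {k} i≢k rewrite dec-false (i ℤ.≟ k) i≢k = ≡.refl

  N-offset : ∀ a b j s → N a b (j ℤ.+ + s) j ≡
    b ^ s * (poch (a / b) s / poch q s)
          * (poch (u * q ^ℤ j) s / poch (v * q ^ℤ (j ℤ.+ ℤ.1ℤ)) s)
          * (poch (v * v * q ^ℤ (+ 2 ℤ.* j ℤ.+ ℤ.1ℤ)) (s ℕ.+ s)
              / (poch (a * (v * v) * q ^ℤ (j ℤ.+ + s ℤ.+ j)) s * poch (b * (v * v) * q ^ℤ (+ 2 ℤ.* j ℤ.+ ℤ.1ℤ)) s))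
  N-offset a b j s rewrite dec-false (j ℤ.+ + s ℤ.<? j) (j+s≮j j s) | ∣j+s-j∣≡s j s = ≡.refl

  -- Numerator and denominator of N a b (j + s) j, with J standing for q ^ℤ j.
  entryNum : Carrier → Carrier → Carrier → ℕ → Carrier
  entryNum a b J s = homPoch b a s * poch (u * J) s * poch (v * v * (J * J * q)) (s ℕ.+ s)

  entryDen : Carrier → Carrier → Carrier → ℕ → Carrier
  entryDen a b J s =
    poch q s * poch (v * (J * q)) s * (poch (a * (v * v) * (J * J * q ^ s)) s * poch (b * (v * v) * (J * J * q)) s)

  module _ (q≉0 : q ≉ 0#) (q-factor≉0 : ∀ m → 1# - q ^ suc m ≉ 0#) (v-factor≉0 : ∀ z → 1# - v * q ^ℤ z ≉ 0#) where

    q^ℤ[j+1] : ∀ j → q ^ℤ (j ℤ.+ ℤ.1ℤ) ≈ q ^ℤ j * q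
    q^ℤ[j+1] j = trans (^ℤ-+ q≉0 j ℤ.1ℤ) (*-congˡ (*-identityʳ q))

    q^ℤ[2j+1] : ∀ j → q ^ℤ (+ 2 ℤ.* j ℤ.+ ℤ.1ℤ) ≈ q ^ℤ j * q ^ℤ j * q
    q^ℤ[2j+1] j = begin
      q ^ℤ (+ 2 ℤ.* j ℤ.+ ℤ.1ℤ)     ≈⟨ q^ℤ[j+1] (+ 2 ℤ.* j) ⟩
      q ^ℤ (+ 2 ℤ.* j) * q          ≡⟨ ≡.cong (λ i → q ^ℤ i * q) (2j≡j+j j) ⟩
      q ^ℤ (j ℤ.+ j) * q            ≈⟨ *-congʳ (^ℤ-+ q≉0 j j) ⟩
      q ^ℤ j * q ^ℤ j * q           ∎

    q^ℤ[j+s+j] : ∀ j s → q ^ℤ (j ℤ.+ + s ℤ.+ j) ≈ q ^ℤ j * q ^ℤ j * q ^ s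
    q^ℤ[j+s+j] j s = begin
      q ^ℤ (j ℤ.+ + s ℤ.+ j)          ≈⟨ ^ℤ-+ q≉0 (j ℤ.+ + s) j ⟩
      q ^ℤ (j ℤ.+ + s) * q ^ℤ j       ≈⟨ *-congʳ (^ℤ-+ q≉0 j (+ s)) ⟩
      q ^ℤ j * q ^ s * q ^ℤ j         ≈⟨ swap (q ^ℤ j) (q ^ s) ⟩
      q ^ℤ j * q ^ℤ j * q ^ s         ∎
      where
      swap : ∀ J P → J * P * J ≈ J * J * P
      swap = solve 2 (λ J P → J :* P :* J := J :* J :* P) refl

    N*entryDen≈entryNum : ∀ {a b} → b ≉ 0# →
            (∀ z → 1# - a * (v * v) * q ^ℤ z ≉ 0#) → (∀ z → 1# - b * (v * v) * q ^ℤ z ≉ 0#) →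
            ∀ j s → N a b (j ℤ.+ + s) j * entryDen a b (q ^ℤ j) s ≈ entryNum a b (q ^ℤ j) s
    N*entryDen≈entryNum {a} {b} b≉0 a-factor≉0 b-factor≉0 j s = begin
      N a b (j ℤ.+ + s) j * entryDen a b J s                      ≈⟨ *-congˡ denominator ⟨
      N a b (j ℤ.+ + s) j * (B * D * G)                           ≡⟨ ≡.cong (_* (B * D * G)) (N-offset a b j s) ⟩
      b ^ s * (A / B) * (C / D) * (E / G) * (B * D * G)           ≈⟨ p*[a/b]*[c/d]*[e/g]*[b*d*g]≈p*a*c*e B≉0 D≉0 G≉0 _ A C E ⟩
      b ^ s * A * C * E                                           ≈⟨ numerator ⟩
      entryNum a b J s                                            ∎
      where
      J A B C D E G : Carrier
      J = q ^ℤ j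
      A = poch (a / b) s
      B = poch q s
      C = poch (u * J) s
      D = poch (v * q ^ℤ (j ℤ.+ ℤ.1ℤ)) s
      E = poch (v * v * q ^ℤ (+ 2 ℤ.* j ℤ.+ ℤ.1ℤ)) (s ℕ.+ s)
      G = poch (a * (v * v) * q ^ℤ (j ℤ.+ + s ℤ.+ j)) s * poch (b * (v * v) * q ^ℤ (+ 2 ℤ.* j ℤ.+ ℤ.1ℤ)) s
      B≉0 : B ≉ 0#
      B≉0 = poch-≉0 q-factor≉0 s
      D≉0 : D ≉ 0#
      D≉0 = poch-≉0 (*q^ℤ-factor≉0 q≉0 v-factor≉0 (j ℤ.+ ℤ.1ℤ)) s
      G≉0 : G ≉ 0#
      G≉0 = *-≉0 (poch-≉0 (*q^ℤ-factor≉0 q≉0 a-factor≉0 (j ℤ.+ + s ℤ.+ j)) s)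
                 (poch-≉0 (*q^ℤ-factor≉0 q≉0 b-factor≉0 (+ 2 ℤ.* j ℤ.+ ℤ.1ℤ)) s)
      denominator : B * D * G ≈ entryDen a b J s
      denominator = *-cong (*-congˡ (poch-cong (*-congˡ (q^ℤ[j+1] j)) s))
                           (*-cong (poch-cong (*-congˡ (q^ℤ[j+s+j] j s)) s) (poch-cong (*-congˡ (q^ℤ[2j+1] j)) s))
      numerator : b ^ s * A * C * E ≈ entryNum a b J s
      numerator = *-cong (*-congʳ (^*poch[/]≈homPoch b≉0 s)) (poch-cong (*-congˡ (q^ℤ[2j+1] j)) (s ℕ.+ s))

    N-offset-zero : ∀ {a b} → b ≉ 0# →
                    (∀ z → 1# - a * (v * v) * q ^ℤ z ≉ 0#) → (∀ z → 1# - b * (v * v) * q ^ℤ z ≉ 0#) →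
                    ∀ j → N a b (j ℤ.+ + 0) j ≈ 1#
    N-offset-zero {a} {b} b≉0 a-factor≉0 b-factor≉0 j = begin
      N a b (j ℤ.+ + 0) j                          ≈⟨ *-identityʳ _ ⟨
      N a b (j ℤ.+ + 0) j * 1#                     ≈⟨ *-congˡ ones ⟩
      N a b (j ℤ.+ + 0) j * (1# * 1# * (1# * 1#))  ≈⟨ N*entryDen≈entryNum b≉0 a-factor≉0 b-factor≉0 j 0 ⟩
      1# * 1# * 1#                                 ≈⟨ trans (*-identityʳ _) (*-identityʳ 1#) ⟩
      1#                                           ∎
      where
      ones : 1# ≈ 1# * 1# * (1# * 1#)
      ones = sym (trans (*-cong (*-identityʳ 1#) (*-identityʳ 1#)) (*-identityʳ 1#))

    N-diagonal : ∀ {a b} → b ≉ 0# →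
                 (∀ z → 1# - a * (v * v) * q ^ℤ z ≉ 0#) → (∀ z → 1# - b * (v * v) * q ^ℤ z ≉ 0#) →
                 ∀ j → N a b j j ≈ 1#
    N-diagonal b≉0 a-factor≉0 b-factor≉0 j =
      ≡.subst (λ i → N _ _ i j ≈ 1#) (ℤ.+-identityʳ j) (N-offset-zero b≉0 a-factor≉0 b-factor≉0 j)

    module Column (x y : Carrier) (x≉0 : x ≉ 0#) (y≉0 : y ≉ 0#)
                  (xv²-factor≉0 : ∀ z → 1# - x * (v * v) * q ^ℤ z ≉ 0#)
                  (yv²-factor≉0 : ∀ z → 1# - y * (v * v) * q ^ℤ z ≉ 0#)
                  (k : ℤ) where

      K U V w : Carrier
      K = q ^ℤ k
      U = u * K
      V = v * K
      w = V * V

      X : ℕ → Carrier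
      X n = x * w * q ^ n

      Cnum Cden : ℕ → Carrier
      Cnum n = poch U n * poch (w * q) (n ℕ.+ n)
      Cden n = poch (V * q) n * poch (X n) n * poch (y * w) (suc n)

      Tnum Tden Gnum : ℕ → ℕ → ℕ → Carrier
      Tnum n s t = homPoch y x s * homPoch x y t * (poch (X n) t * poch (y * w) t * (1# - y * w * q ^ (t ℕ.+ t)))
      Tden n s t = poch q s * poch q t * poch (x * w * q) t * poch (y * w * q ^ suc n) t
      Gnum n s t = homPoch y x s * (1# - q ^ s) * homPoch x (y * q) t * poch (X n) (suc t) * poch (y * w) (suc t)

      C : ℕ → Carrier
      C n = Cnum n / Cden n

      T G : ℕ → ℕ → ℕ → Carrier
      T n s t = Tnum n s t / Tden n s t
      G n s t = Gnum n s t / Tden n s t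

      κ : ℕ → Carrier
      κ n = (1# - X n) * (1# - q ^ n)

      summand : ℤ → ℤ → Carrier
      summand i j = N x y i j * N y x j k

      v²*[K*K*q]≈w*q : v * v * (K * K * q) ≈ w * q
      v²*[K*K*q]≈w*q = solve 3 (λ v K q → v :* v :* (K :* K :* q) := v :* K :* (v :* K) :* q) refl v K q

      a*v²*[K*K*R]≈a*w*R : ∀ a R → a * (v * v) * (K * K * R) ≈ a * w * R
      a*v²*[K*K*R]≈a*w*R a R = solve 4 (λ a v K R → a :* (v :* v) :* (K :* K :* R) := a :* (v :* K :* (v :* K)) :* R) refl a v K R

      w-factor≉0 : ∀ {a} → (∀ z → 1# - a * (v * v) * q ^ℤ z ≉ 0#) → ∀ m → 1# - a * w * q ^ m ≉ 0#
      w-factor≉0 {a} factor≉0 m eq = *q^ℤ-factor≉0 q≉0 factor≉0 (k ℤ.+ k) m (trans (+-congˡ (-‿cong (sym shift))) eq)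
        where
        shift : a * w * q ^ m ≈ a * (v * v) * q ^ℤ (k ℤ.+ k) * q ^ m
        shift = begin
          a * w * q ^ m                          ≈⟨ a*v²*[K*K*R]≈a*w*R a (q ^ m) ⟨
          a * (v * v) * (K * K * q ^ m)          ≈⟨ *-congˡ (*-congʳ (^ℤ-+ q≉0 k k)) ⟨
          a * (v * v) * (q ^ℤ (k ℤ.+ k) * q ^ m) ≈⟨ *-assoc _ _ _ ⟨
          a * (v * v) * q ^ℤ (k ℤ.+ k) * q ^ m   ∎

      xw-factor≉0 : ∀ m → 1# - x * w * q ^ m ≉ 0#
      xw-factor≉0 = w-factor≉0 xv²-factor≉0

      yw-factor≉0 : ∀ m → 1# - y * w * q ^ m ≉ 0#
      yw-factor≉0 = w-factor≉0 yv²-factor≉0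

      Cden≉0 : ∀ n → Cden n ≉ 0#
      Cden≉0 n = *-≉0 (*-≉0 (poch-≉0 (*q-factor≉0 (*q^ℤ-factor≉0 q≉0 v-factor≉0 k)) n)
                            (poch-≉0 (*q^-factor≉0 xw-factor≉0 n) n))
                      (poch-≉0 yw-factor≉0 (suc n))

      Tden≉0 : ∀ n s t → Tden n s t ≉ 0#
      Tden≉0 n s t = *-≉0 (*-≉0 (*-≉0 (poch-≉0 q-factor≉0 s) (poch-≉0 q-factor≉0 t))
                                (poch-≉0 (*q-factor≉0 xw-factor≉0) t))
                          (poch-≉0 (*q^-factor≉0 yw-factor≉0 (suc n)) t)

      κ≉0 : ∀ n → κ (suc n) ≉ 0#
      κ≉0 n = *-≉0 (xw-factor≉0 (suc n)) (q-factor≉0 n)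

      module Factorisation (t : ℕ) where

        J P : Carrier
        J = q ^ℤ (k ℤ.+ + t)
        P = q ^ t

        J≈K*P : J ≈ K * P
        J≈K*P = ^ℤ-+ q≉0 k (+ t)

        u*J≈U*P : u * J ≈ U * P
        u*J≈U*P = trans (*-congˡ J≈K*P) (sym (*-assoc u K P))

        v*[J*q]≈V*q*P : v * (J * q) ≈ V * q * P
        v*[J*q]≈V*q*P = trans (*-congˡ (*-congʳ J≈K*P)) (regroup v K P q)
          where
          regroup : ∀ v K P q → v * (K * P * q) ≈ v * K * q * P
          regroup = solve 4 (λ v K P q → v :* (K :* P :* q) := v :* K :* q :* P) refl

        a*v²*[J*J*R]≈a*w*[P*P*R] : ∀ a R → a * (v * v) * (J * J * R) ≈ a * w * (P * P * R)
        a*v²*[J*J*R]≈a*w*[P*P*R] a R = trans (*-congˡ (*-congʳ (*-cong J≈K*P J≈K*P))) (regroup a v K P R)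
          where
          regroup : ∀ a v K P R → a * (v * v) * (K * P * (K * P) * R) ≈ a * (v * K * (v * K)) * (P * P * R)
          regroup = solve 5 (λ a v K P R → a :* (v :* v) :* (K :* P :* (K :* P) :* R)
                                          := a :* (v :* K :* (v :* K)) :* (P :* P :* R)) refl

        v²*[J*J*q]≈w*q*q^[t+t] : v * v * (J * J * q) ≈ w * q * q ^ (t ℕ.+ t)
        v²*[J*J*q]≈w*q*q^[t+t] = begin
          v * v * (J * J * q)              ≈⟨ *-congʳ (*-identityˡ _) ⟨
          1# * (v * v) * (J * J * q)       ≈⟨ a*v²*[J*J*R]≈a*w*[P*P*R] 1# q ⟩
          1# * w * (P * P * q)             ≈⟨ regroup w P q ⟩
          w * q * (P * P)                  ≈⟨ *-congˡ (^-+ q t t) ⟨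
          w * q * q ^ (t ℕ.+ t)            ∎
          where
          regroup : ∀ w P q → 1# * w * (P * P * q) ≈ w * q * (P * P)
          regroup = solve 3 (λ w P q → con (+ 1) :* w :* (P :* P :* q) := w :* q :* (P :* P)) refl

        numerators : ∀ s → entryNum x y J s * entryNum y x K t ≈ Cnum (t ℕ.+ s) * (homPoch y x s * homPoch x y t)
        numerators s = begin
          (Hs * poch (u * J) s * poch (v * v * (J * J * q)) (s ℕ.+ s)) * (Ht * poch U t * poch (v * v * (K * K * q)) (t ℕ.+ t))
            ≈⟨ *-cong (*-cong (*-congˡ (poch-cong u*J≈U*P s)) (poch-cong v²*[J*J*q]≈w*q*q^[t+t] (s ℕ.+ s)))
                      (*-congˡ (poch-cong (v²*[K*K*q]≈w*q) (t ℕ.+ t))) ⟩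
          (Hs * poch (U * P) s * poch (w * q * q ^ (t ℕ.+ t)) (s ℕ.+ s)) * (Ht * poch U t * poch (w * q) (t ℕ.+ t))
            ≈⟨ regroup Hs Ht (poch (U * P) s) (poch U t) (poch (w * q * q ^ (t ℕ.+ t)) (s ℕ.+ s)) (poch (w * q) (t ℕ.+ t)) ⟩
          poch U t * poch (U * P) s * (poch (w * q) (t ℕ.+ t) * poch (w * q * q ^ (t ℕ.+ t)) (s ℕ.+ s)) * (Hs * Ht)
            ≈⟨ *-congʳ (*-cong (poch-+ U t s) (poch-+ (w * q) (t ℕ.+ t) (s ℕ.+ s))) ⟨
          poch U (t ℕ.+ s) * poch (w * q) ((t ℕ.+ t) ℕ.+ (s ℕ.+ s)) * (Hs * Ht)
            ≡⟨ ≡.cong (λ m → poch U (t ℕ.+ s) * poch (w * q) m * (Hs * Ht)) ([t+s]+[t+s]≡[t+t]+[s+s] t s) ⟨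
          Cnum (t ℕ.+ s) * (Hs * Ht)
            ∎
          where
          Hs Ht : Carrier
          Hs = homPoch y x s
          Ht = homPoch x y t
          regroup : ∀ Hs Ht Us Ut Ws Wt → (Hs * Us * Ws) * (Ht * Ut * Wt) ≈ Ut * Us * (Wt * Ws) * (Hs * Ht)
          regroup = solve 6 (λ Hs Ht Us Ut Ws Wt → (Hs :* Us :* Ws) :* (Ht :* Ut :* Wt) := Ut :* Us :* (Wt :* Ws) :* (Hs :* Ht)) refl

        x*v²*[J*J*q^s]≈X[t+s]*P : ∀ s → x * (v * v) * (J * J * q ^ s) ≈ X (t ℕ.+ s) * P
        x*v²*[J*J*q^s]≈X[t+s]*P s = begin
          x * (v * v) * (J * J * q ^ s)       ≈⟨ a*v²*[J*J*R]≈a*w*[P*P*R] x (q ^ s) ⟩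
          x * w * (P * P * q ^ s)             ≈⟨ regroup x w P (q ^ s) ⟩
          x * w * (P * q ^ s) * P             ≈⟨ *-congʳ (*-congˡ (^-+ q t s)) ⟨
          X (t ℕ.+ s) * P                     ∎
          where
          regroup : ∀ x w P Q → x * w * (P * P * Q) ≈ x * w * (P * Q) * P
          regroup = solve 4 (λ x w P Q → x :* w :* (P :* P :* Q) := x :* w :* (P :* Q) :* P) refl

        y*v²*[J*J*q]≈y*w*q^[1+t+t] : y * (v * v) * (J * J * q) ≈ y * w * q ^ suc (t ℕ.+ t)
        y*v²*[J*J*q]≈y*w*q^[1+t+t] = begin
          y * (v * v) * (J * J * q)           ≈⟨ a*v²*[J*J*R]≈a*w*[P*P*R] y q ⟩
          y * w * (P * P * q)                 ≈⟨ *-congˡ (*-comm _ q) ⟩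
          y * w * (q * (P * P))               ≈⟨ *-congˡ (*-congˡ (^-+ q t t)) ⟨
          y * w * q ^ suc (t ℕ.+ t)           ∎

        denominators : ∀ s → let n = t ℕ.+ s in
          Cden n * Tden n s t ≈
            entryDen x y J s * entryDen y x K t * (poch (X n) t * poch (y * w) t * (1# - y * w * q ^ (t ℕ.+ t)))
        denominators s = begin
          Cden n * Tden n s t
            ≈⟨ *-congʳ (*-congʳ (*-cong (poch-+ (V * q) t s) (poch-+ (X n) t s))) ⟩
          Vt * Vs * (Xt * Xs) * Yn * (ps * pt * Zt * Wt)
            ≈⟨ regroup₁ Vt Vs Xt Xs Yn ps pt Zt Wt ⟩
          Vt * Vs * (Xt * Xs) * (ps * pt * Zt) * (Yn * Wt)
            ≈⟨ *-congˡ (poch-[1+t+s]+t (y * w) t s) ⟩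
          Vt * Vs * (Xt * Xs) * (ps * pt * Zt) * (Yt * Yt′ * Yf * Ys)
            ≈⟨ regroup₂ Vt Vs Xt Xs ps pt Zt Yt Yt′ Yf Ys ⟩
          ps * Vs * (Xs * Ys) * (pt * Vt * (Yt′ * Zt)) * (Xt * Yt * Yf)
            ≈⟨ *-congʳ (*-cong xy-side yx-side) ⟨
          entryDen x y J s * entryDen y x K t * (Xt * Yt * Yf)
            ∎
          where
          n : ℕ
          n = t ℕ.+ s
          ps pt Vt Vs Xt Xs Yn Yt Yt′ Yf Ys Zt Wt : Carrier
          ps = poch q s
          pt = poch q t
          Vt = poch (V * q) t
          Vs = poch (V * q * P) s
          Xt = poch (X n) t
          Xs = poch (X n * P) s
          Yn = poch (y * w) (suc n)
          Yt = poch (y * w) t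
          Yt′ = poch (y * w * P) t
          Yf = 1# - y * w * q ^ (t ℕ.+ t)
          Ys = poch (y * w * q ^ suc (t ℕ.+ t)) s
          Zt = poch (x * w * q) t
          Wt = poch (y * w * q ^ suc n) t
          xy-side : entryDen x y J s ≈ ps * Vs * (Xs * Ys)
          xy-side = *-cong (*-congˡ (poch-cong v*[J*q]≈V*q*P s))
                           (*-cong (poch-cong (x*v²*[J*J*q^s]≈X[t+s]*P s) s) (poch-cong y*v²*[J*J*q]≈y*w*q^[1+t+t] s))
          yx-side : entryDen y x K t ≈ pt * Vt * (Yt′ * Zt)
          yx-side = *-cong (*-congˡ (poch-cong (sym (*-assoc v K q)) t))
                           (*-cong (poch-cong (a*v²*[K*K*R]≈a*w*R y P) t) (poch-cong (a*v²*[K*K*R]≈a*w*R x q) t))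
          regroup₁ : ∀ Vt Vs Xt Xs Yn ps pt Zt Wt →
            Vt * Vs * (Xt * Xs) * Yn * (ps * pt * Zt * Wt) ≈ Vt * Vs * (Xt * Xs) * (ps * pt * Zt) * (Yn * Wt)
          regroup₁ = solve 9 (λ Vt Vs Xt Xs Yn ps pt Zt Wt →
            Vt :* Vs :* (Xt :* Xs) :* Yn :* (ps :* pt :* Zt :* Wt) := Vt :* Vs :* (Xt :* Xs) :* (ps :* pt :* Zt) :* (Yn :* Wt)) refl
          regroup₂ : ∀ Vt Vs Xt Xs ps pt Zt Yt Yt′ Yf Ys →
            Vt * Vs * (Xt * Xs) * (ps * pt * Zt) * (Yt * Yt′ * Yf * Ys) ≈ ps * Vs * (Xs * Ys) * (pt * Vt * (Yt′ * Zt)) * (Xt * Yt * Yf)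
          regroup₂ = solve 11 (λ Vt Vs Xt Xs ps pt Zt Yt Yt′ Yf Ys →
            Vt :* Vs :* (Xt :* Xs) :* (ps :* pt :* Zt) :* (Yt :* Yt′ :* Yf :* Ys) := ps :* Vs :* (Xs :* Ys) :* (pt :* Vt :* (Yt′ :* Zt)) :* (Xt :* Yt :* Yf)) refl

        entry-product : ∀ s → summand (k ℤ.+ + t ℤ.+ + s) (k ℤ.+ + t) ≈ C (t ℕ.+ s) * T (t ℕ.+ s) s t
        entry-product s = x*[b*d]≈a*c⇒x≈[a/b]*[c/d] (Cden≉0 n) (Tden≉0 n s t) (begin
          e₁ * e₂ * (Cden n * Tden n s t)                  ≈⟨ *-congˡ (denominators s) ⟩
          e₁ * e₂ * (D₁ * D₂ * R)                          ≈⟨ regroup e₁ e₂ D₁ D₂ R ⟩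
          e₁ * D₁ * (e₂ * D₂) * R                          ≈⟨ *-congʳ (*-cong (N*entryDen≈entryNum y≉0 xv²-factor≉0 yv²-factor≉0 (k ℤ.+ + t) s)
                                                                               (N*entryDen≈entryNum x≉0 yv²-factor≉0 xv²-factor≉0 k t)) ⟩
          entryNum x y J s * entryNum y x K t * R          ≈⟨ *-congʳ (numerators s) ⟩
          Cnum n * (homPoch y x s * homPoch x y t) * R     ≈⟨ *-assoc _ _ _ ⟩
          Cnum n * Tnum n s t                              ∎)
          where
          n : ℕ
          n = t ℕ.+ s
          e₁ e₂ D₁ D₂ R : Carrier
          e₁ = N x y (k ℤ.+ + t ℤ.+ + s) (k ℤ.+ + t)
          e₂ = N y x (k ℤ.+ + t) k
          D₁ = entryDen x y J s
          D₂ = entryDen y x K t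
          R = poch (X n) t * poch (y * w) t * (1# - y * w * q ^ (t ℕ.+ t))
          regroup : ∀ e₁ e₂ D₁ D₂ R → e₁ * e₂ * (D₁ * D₂ * R) ≈ e₁ * D₁ * (e₂ * D₂) * R
          regroup = solve 5 (λ e₁ e₂ D₁ D₂ R → e₁ :* e₂ :* (D₁ :* D₂ :* R) := e₁ :* D₁ :* (e₂ :* D₂) :* R) refl

      -- What remains of κ n * T n s (t + 1) = G n s (t + 1) - G n (s + 1) t once the common
      -- factors are cancelled, with Q = q ^ s, P = q ^ t and M = q ^ n = Q q P.
      certificate-lhs certificate-rhs : Carrier → Carrier → Carrier → Carrier
      certificate-lhs Q P M = (y - x * Q) * (1# - q * P) * (1# - x * w * q * P) * (1# - y * w * (q * M) * P)
      certificate-rhs Q P M =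
        (1# - Q) * (x - y * q * P) * (1# - x * w * M * (q * P)) * (1# - y * w * (q * P))
          - (1# - x * w * M) * (1# - M) * (x - y) * (1# - y * w * (q * (P * (q * P))))

      certificate-identity : ∀ Q P → certificate-lhs Q P (Q * (q * P)) ≈ certificate-rhs Q P (Q * (q * P))
      certificate-identity Q P = solve 6 (λ q Q P x y w →
        (y :- x :* Q) :* (con (+ 1) :- q :* P) :* (con (+ 1) :- x :* w :* q :* P) :* (con (+ 1) :- y :* w :* (q :* (Q :* (q :* P))) :* P)
          := (con (+ 1) :- Q) :* (x :- y :* q :* P) :* (con (+ 1) :- x :* w :* (Q :* (q :* P)) :* (q :* P)) :* (con (+ 1) :- y :* w :* (q :* P))
             :- (con (+ 1) :- x :* w :* (Q :* (q :* P))) :* (con (+ 1) :- Q :* (q :* P)) :* (x :- y)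
                :* (con (+ 1) :- y :* w :* (q :* (P :* (q :* P))))) refl q Q P x y w

      certificate-core : ∀ {Q P M} → M ≈ Q * (q * P) → certificate-lhs Q P M ≈ certificate-rhs Q P M
      certificate-core {Q} {P} {M} M≈ = begin
        certificate-lhs Q P M                ≈⟨ *-congˡ (+-congˡ (-‿cong (*-congʳ (*-congˡ (*-congˡ M≈))))) ⟩
        certificate-lhs Q P (Q * (q * P))    ≈⟨ certificate-identity Q P ⟩
        certificate-rhs Q P (Q * (q * P))    ≈⟨ +-cong (*-congʳ (*-congˡ (+-congˡ (-‿cong (*-congʳ (*-congˡ M≈))))))
                                                       (-‿cong (*-congʳ (*-congʳ (*-cong (+-congˡ (-‿cong (*-congˡ M≈)))
                                                                                          (+-congˡ (-‿cong M≈)))))) ⟨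
        certificate-rhs Q P M                ∎

      certificate-cross : ∀ s t → let n = s ℕ.+ suc t in
        Gnum n (suc s) t * Tden n s (suc t) ≈ (Gnum n s (suc t) - κ n * Tnum n s (suc t)) * Tden n (suc s) t
      certificate-cross s t = begin
        Gnum n (suc s) t * Tden n s (suc t)
          ≈⟨ regroup₁ Hs Ht Xt Yt ps pt Zt Wt _ _ _ _ _ _ _ ⟩
        common * certificate-lhs Q P (q ^ n) * (1# - q * Q)
          ≈⟨ *-congʳ (*-congˡ (certificate-core (^-+ q s (suc t)))) ⟩
        common * certificate-rhs Q P (q ^ n) * (1# - q * Q)
          ≈⟨ regroup₂ Hs Ht Xt Yt ps pt Zt Wt _ _ _ _ _ _ _ _ _ _ ⟨
        (Gnum n s (suc t) - κ n * (Hs * ((x - y) * Ht) * (Xt * (1# - X n * P) * (Yt * (1# - y * w * P)) * (1# - y * w * (q * (P * (q * P)))))))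
          * Tden n (suc s) t
          ≈⟨ *-congʳ (+-congˡ (-‿cong (*-congˡ (*-cong (*-congˡ (homPoch-suc x y t))
                                                      (*-congˡ (+-congˡ (-‿cong (*-congˡ (*-congˡ (^-+ q t (suc t))))))))))) ⟨
        (Gnum n s (suc t) - κ n * Tnum n s (suc t)) * Tden n (suc s) t
          ∎
        where
        n : ℕ
        n = s ℕ.+ suc t
        Q P Hs Ht Xt Yt ps pt Zt Wt common : Carrier
        Q = q ^ s
        P = q ^ t
        Hs = homPoch y x s
        Ht = homPoch x (y * q) t
        Xt = poch (X n) t
        Yt = poch (y * w) t
        ps = poch q s
        pt = poch q t
        Zt = poch (x * w * q) t
        Wt = poch (y * w * q ^ suc n) t
        common = Hs * Ht * Xt * (1# - X n * P) * Yt * (1# - y * w * P) * ps * pt * Zt * Wt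
        regroup₁ : ∀ Hs Ht Xt Yt ps pt Zt Wt f₁ f₂ f₃ f₄ f₅ f₆ f₇ →
          Hs * f₁ * f₂ * Ht * (Xt * f₃) * (Yt * f₄) * (ps * (pt * f₅) * (Zt * f₆) * (Wt * f₇))
            ≈ Hs * Ht * Xt * f₃ * Yt * f₄ * ps * pt * Zt * Wt * (f₁ * f₅ * f₆ * f₇) * f₂
        regroup₁ = solve 15 (λ Hs Ht Xt Yt ps pt Zt Wt f₁ f₂ f₃ f₄ f₅ f₆ f₇ →
          Hs :* f₁ :* f₂ :* Ht :* (Xt :* f₃) :* (Yt :* f₄) :* (ps :* (pt :* f₅) :* (Zt :* f₆) :* (Wt :* f₇))
            := Hs :* Ht :* Xt :* f₃ :* Yt :* f₄ :* ps :* pt :* Zt :* Wt :* (f₁ :* f₅ :* f₆ :* f₇) :* f₂) refl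
        regroup₂ : ∀ Hs Ht Xt Yt ps pt Zt Wt f₂ f₃ f₄ g₁ g₂ g₃ g₄ k d g₅ →
          (Hs * g₁ * (Ht * g₂) * (Xt * f₃ * g₃) * (Yt * f₄ * g₄) - k * (Hs * (d * Ht) * (Xt * f₃ * (Yt * f₄) * g₅)))
            * (ps * f₂ * pt * Zt * Wt)
            ≈ Hs * Ht * Xt * f₃ * Yt * f₄ * ps * pt * Zt * Wt * (g₁ * g₂ * g₃ * g₄ - k * d * g₅) * f₂
        regroup₂ = solve 18 (λ Hs Ht Xt Yt ps pt Zt Wt f₂ f₃ f₄ g₁ g₂ g₃ g₄ k d g₅ →
          (Hs :* g₁ :* (Ht :* g₂) :* (Xt :* f₃ :* g₃) :* (Yt :* f₄ :* g₄) :- k :* (Hs :* (d :* Ht) :* (Xt :* f₃ :* (Yt :* f₄) :* g₅)))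
            :* (ps :* f₂ :* pt :* Zt :* Wt)
            := Hs :* Ht :* Xt :* f₃ :* Yt :* f₄ :* ps :* pt :* Zt :* Wt :* (g₁ :* g₂ :* g₃ :* g₄ :- k :* d :* g₅) :* f₂) refl

      certificate-step : ∀ n s t → s ℕ.+ suc t ≡ n → G n (suc s) t + κ n * T n s (suc t) ≈ G n s (suc t)
      certificate-step _ s t ≡.refl = begin
        G n (suc s) t + κ n * T n s (suc t)
          ≈⟨ +-congˡ (*-assoc _ _ _) ⟨
        Gnum n (suc s) t / Tden n (suc s) t + κ n * Tnum n s (suc t) / Tden n s (suc t)
          ≈⟨ c*b≈[a-e]*d⇒c/d+e/b≈a/b (Tden≉0 n s (suc t)) (Tden≉0 n (suc s) t) (certificate-cross s t) ⟩
        G n s (suc t)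
          ∎
        where
        n : ℕ
        n = s ℕ.+ suc t

      open Factorisation using (entry-product)

      column-entry : ∀ n t → t ℕ.≤ n → summand (k ℤ.+ + n) (k ℤ.+ + t) ≈ C n * T n (n ℕ.∸ t) t
      column-entry n t t≤n = begin
        summand (k ℤ.+ + n) (k ℤ.+ + t)
          ≡⟨ ≡.cong (λ i → summand i (k ℤ.+ + t)) (k+n≡k+t+[n∸t] k t≤n) ⟩
        summand (k ℤ.+ + t ℤ.+ + (n ℕ.∸ t)) (k ℤ.+ + t)
          ≈⟨ entry-product t (n ℕ.∸ t) ⟩
        C (t ℕ.+ (n ℕ.∸ t)) * T (t ℕ.+ (n ℕ.∸ t)) (n ℕ.∸ t) t
          ≡⟨ ≡.cong (λ m → C m * T m (n ℕ.∸ t) t) (ℕ.m+[n∸m]≡n t≤n) ⟩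
        C n * T n (n ℕ.∸ t) t
          ∎

      κ*T[n,n,0]≈G[n,n,0] : ∀ n → κ n * T n n 0 ≈ G n n 0
      κ*T[n,n,0]≈G[n,n,0] n = trans (sym (*-assoc _ _ _)) (*-congʳ (identity (X n) (q ^ n) (homPoch y x n) y w))
        where
        identity : ∀ X qⁿ H y w →
          (1# - X) * (1# - qⁿ) * (H * 1# * (1# * 1# * (1# - y * w * 1#)))
            ≈ H * (1# - qⁿ) * 1# * (1# * (1# - X * 1#)) * (1# * (1# - y * w * 1#))
        identity = solve 5 (λ X qⁿ H y w →
          (con (+ 1) :- X) :* (con (+ 1) :- qⁿ) :* (H :* con (+ 1) :* (con (+ 1) :* con (+ 1) :* (con (+ 1) :- y :* w :* con (+ 1))))
            := H :* (con (+ 1) :- qⁿ) :* con (+ 1) :* (con (+ 1) :* (con (+ 1) :- X :* con (+ 1))) :* (con (+ 1) :* (con (+ 1) :- y :* w :* con (+ 1)))) refl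

      G[n,0,n]≈0 : ∀ n → G n 0 n ≈ 0#
      G[n,0,n]≈0 n = trans (*-congʳ (vanishing _ _ _)) (zeroˡ _)
        where
        vanishing : ∀ A B D → 1# * (1# - 1#) * A * B * D ≈ 0#
        vanishing = solve 3 (λ A B D → con (+ 1) :* (con (+ 1) :- con (+ 1)) :* A :* B :* D := con (+ 0)) refl

      T-sum≈0 : ∀ n → sumUpTo F (suc n) (λ t → T (suc n) (suc n ℕ.∸ t) t) ≈ 0#
      T-sum≈0 n = x*y≈0⇒y≈0 (κ≉0 n) (begin
        κ m * sumUpTo F m (λ t → T m (m ℕ.∸ t) t)         ≈⟨ sumUpTo-*ˡ m (κ m) _ ⟨
        sumUpTo F m (λ t → κ m * T m (m ℕ.∸ t) t)         ≈⟨ telescope m _ (λ t → G m (m ℕ.∸ t) t) (κ*T[n,n,0]≈G[n,n,0] m) step ⟩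
        G m (m ℕ.∸ m) m                                   ≡⟨ ≡.cong (λ s → G m s m) (ℕ.n∸n≡0 m) ⟩
        G m 0 m                                           ≈⟨ G[n,0,n]≈0 m ⟩
        0#                                                ∎)
        where
        m : ℕ
        m = suc n
        step : ∀ t → t ℕ.< m → G m (m ℕ.∸ t) t + κ m * T m (m ℕ.∸ suc t) (suc t) ≈ G m (m ℕ.∸ suc t) (suc t)
        step t t<m rewrite n∸t≡1+[n∸[1+t]] t<m = certificate-step m (m ℕ.∸ suc t) t (ℕ.m∸n+n≡m t<m)

      column-sum-offset : ∀ n → sumBetween F k (k ℤ.+ + n) (summand (k ℤ.+ + n)) ≈ δ F (k ℤ.+ + n) k
      column-sum-offset zero = begin
        sumBetween F k (k ℤ.+ + 0) (summand (k ℤ.+ + 0))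
          ≡⟨ sumBetween-offset k 0 (summand (k ℤ.+ + 0)) ⟩
        summand (k ℤ.+ + 0) (k ℤ.+ + 0)
          ≈⟨ *-cong (N-diagonal y≉0 xv²-factor≉0 yv²-factor≉0 (k ℤ.+ + 0)) (N-offset-zero x≉0 yv²-factor≉0 xv²-factor≉0 k) ⟩
        1# * 1#
          ≈⟨ *-identityʳ 1# ⟩
        1#
          ≡⟨ δ-≡ (ℤ.+-identityʳ k) ⟨
        δ F (k ℤ.+ + 0) k
          ∎
      column-sum-offset (suc n) = begin
        sumBetween F k (k ℤ.+ + m) (summand (k ℤ.+ + m))
          ≡⟨ sumBetween-offset k m (summand (k ℤ.+ + m)) ⟩
        sumUpTo F m (λ t → summand (k ℤ.+ + m) (k ℤ.+ + t))
          ≈⟨ sumUpTo-cong m (column-entry m) ⟩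
        sumUpTo F m (λ t → C m * T m (m ℕ.∸ t) t)
          ≈⟨ sumUpTo-*ˡ m (C m) _ ⟩
        C m * sumUpTo F m (λ t → T m (m ℕ.∸ t) t)
          ≈⟨ *-congˡ (T-sum≈0 n) ⟩
        C m * 0#
          ≈⟨ zeroʳ _ ⟩
        0#
          ≡⟨ δ-≢ (k+[1+n]≢k k n) ⟨
        δ F (k ℤ.+ + m) k
          ∎
        where
        m : ℕ
        m = suc n

      column-sum : ∀ i → sumBetween F k i (summand i) ≈ δ F i k
      column-sum i = by-position (i ℤ.<? k)
        where
        by-position : Dec (i ℤ.< k) → sumBetween F k i (summand i) ≈ δ F i k
        by-position (yes i<k) = reflexive (≡.trans (sumBetween-empty (summand i) i<k)
                                                   (≡.sym (δ-≢ (ℤ.<⇒≢ i<k))))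
        by-position (no i≮k)  = ≡.subst (λ i → sumBetween F k i (summand i) ≈ δ F i k)
                                        (k+∣i-k∣≡i i≮k) (column-sum-offset ∣ i ℤ.- k ∣)

lemma1 : ∀ {c ℓ : Level} (F : Field c ℓ) (q u v x y : Field.Carrier F) →
           Generic F q u v x y →
           MutuallyInverse F (Nmat F q u v x y) (Nmat F q u v y x)
lemma1 F q u v x y (q≉0 , x≉0 , y≉0 , q-factor≉0 , v-factor≉0 , xv²-factor≉0 , yv²-factor≉0) i k =
  MatrixInversion.Column.column-sum F q u v q≉0 q-factor≉0 v-factor≉0 x y x≉0 y≉0 xv²-factor≉0 yv²-factor≉0 k i
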